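{- Let $m\ge1$, $n=2m$, and let $L(x)=\sum_{i=0}^k\alpha_ix^{2^{a_i}}\in \mathbb{F}_{2^m}[x]$ be a linearized polynomial with coefficients $\alpha_i\in\mathbb{F}_{2^m}$ and nonnegative integers $a_i$. Define $$r(L)=\sum_{a\in \mathbb{F}_{2^n}}\chi_n\big((a^{2^m}+a)L(a)\big).$$ Then $$r(L)=2^m\sum_{u\in \mathbb{F}_{2^m}}\chi_m(uL(u))=2^m\sum_{u\in \mathbb{F}_{2^m}}\chi_m\left(\sum_{i=0}^k\alpha_iu^{2^{a_i}+1}\right).$$
   Context: For a positive integer $t$, ${\rm Tr}_1^t(x)=\sum_{i=0}^{t-1}x^{2^i}$ is the absolute trace from $\mathbb{F}_{2^t}$ to $\mathbb{F}_2$ and $\chi_t(x)=(-1)^{{\rm Tr}_1^t(x)}$. $\mathbb{F}_{2^m}$ is regarded as the subfield of $\mathbb{F}_{2^n}$. -}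

module Defs where

open import Data.Nat as ℕ using (ℕ; zero; suc)
open import Data.Integer as ℤ using (ℤ; +_; -[1+_])
open import Data.List using (List; []; _∷_; map; filter; length)
open import Data.List.Relation.Unary.Unique.Propositional using (Unique)
open import Data.List.Membership.Propositional using (_∈_)
open import Data.Product using (_×_; _,_; proj₁; proj₂; ∃)
open import Relation.Binary.PropositionalEquality using (_≡_)
open import Relation.Binary.Definitions using (DecidableEquality)
open import Relation.Nullary using (¬_; yes; no)
open import Algebra.Structures using (IsCommutativeRing)

record GF2 (n : ℕ) : Set₁ where
  infixl 6 _+_
  infixl 7 _*_
  field
    Carrier : Set
    _+_ _*_ : Carrier → Carrier → Carrier
    -_      : Carrier → Carrier
    0# 1#   : Carrier
    isCommutativeRing : IsCommutativeRing _≡_ _+_ _*_ -_ 0# 1#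
    0≢1     : ¬ (0# ≡ 1#)
    inverse : ∀ x → ¬ (x ≡ 0#) → ∃ λ y → x * y ≡ 1#
    char2   : 1# + 1# ≡ 0#
    _≟_     : DecidableEquality Carrier
    elems          : List Carrier
    elems-unique   : Unique elems
    elems-complete : ∀ x → x ∈ elems
    elems-card     : length elems ≡ 2 ℕ.^ n

  _^_ : Carrier → ℕ → Carrier
  x ^ zero  = 1#
  x ^ suc k = x * (x ^ k)

  Σᶠ : List Carrier → Carrier
  Σᶠ []       = 0#
  Σᶠ (x ∷ xs) = x + Σᶠ xs

  Tr : ℕ → Carrier → Carrier
  Tr zero    x = 0#
  Tr (suc t) x = (x ^ (2 ℕ.^ t)) + Tr t x

  χ : ℕ → Carrier → ℤ
  χ t x with Tr t x ≟ 0#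
  ... | yes _ = + 1
  ... | no  _ = -[1+ 0 ]

  -- F_{2^m} regarded as the subfield {u : u^{2^m} = u} of this field
  InSub : ℕ → Carrier → Set
  InSub m u = u ^ (2 ℕ.^ m) ≡ u

  subElems : ℕ → List Carrier
  subElems m = filter (λ u → (u ^ (2 ℕ.^ m)) ≟ u) elems

  -- linearized polynomial L(x) = Σ α_i x^{2^{a_i}}, given as list of pairs (α_i , a_i)
  evalL : List (Carrier × ℕ) → Carrier → Carrier
  evalL []             x = 0#
  evalL ((α , a) ∷ ps) x = α * (x ^ (2 ℕ.^ a)) + evalL ps x

  evalQ : List (Carrier × ℕ) → Carrier → Carrier
  evalQ []             u = 0#
  evalQ ((α , a) ∷ ps) u = α * (u ^ ((2 ℕ.^ a) ℕ.+ 1)) + evalQ ps u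

Σℤ : List ℤ → ℤ
Σℤ []       = + 0
Σℤ (x ∷ xs) = x ℤ.+ Σℤ xs

r : (m : ℕ) → (K : GF2 (2 ℕ.* m)) → List (GF2.Carrier K × ℕ) → ℤ
r m K L = Σℤ (map (λ a → χ (2 ℕ.* m) (((a ^ (2 ℕ.^ m)) + a) * evalL L a)) elems)
  where open GF2 K

module Submission where

-- Write q = 2^m and T a = a^q + a for the relative trace from F_{q²} to F_q.  Every fibre of T
-- lies in the root set of x^q + x + u, so has at most q elements; since T sends the q² elements
-- of F_{q²} into F_q, which has at most q elements, every fibre over F_q has exactly q elements.
-- On the other hand Tr_n(z) = Tr_m(z^q + z), and for z = T(a) L(a) additivity of L and
-- L(a)^q = L(a^q) (the coefficients lie in F_q) give z^q + z = T(a) L(T(a)).  Hence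
-- χ_n(T(a) L(a)) = χ_m(T(a) L(T(a))), and summing over the fibres of T gives
-- r(L) = q Σ_{u ∈ F_q} χ_m(u L(u)); finally u L(u) = Σ α_i u^{2^{a_i}+1}.

open import Defs
open import Level using (0ℓ)
open import Algebra.Bundles using (CommutativeMonoid; CommutativeRing; CommutativeSemiring)
open import Algebra.Structures using (IsCommutativeMonoid; IsCommutativeRing)
open import Data.Bool using (if_then_else_)
open import Data.Empty using (⊥-elim)
open import Data.Integer as ℤ using (ℤ)
import Data.Integer.Properties as ℤ
open import Data.List using (List; []; _∷_; map; filter; length)
open import Data.List.Properties using (map-cong)
open import Data.List.Membership.Propositional using (_∈_)
open import Data.List.Membership.Propositional.Properties using (∈-filter⁺)
open import Data.List.Relation.Unary.All as All using (All)
open import Data.List.Relation.Unary.AllPairs using ([]; _∷_)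
open import Data.List.Relation.Unary.Any using (here; there)
open import Data.List.Relation.Unary.Unique.Propositional using (Unique)
import Data.List.Relation.Unary.Unique.Propositional.Properties as Unique
open import Data.Nat as ℕ using (ℕ; zero; suc; _≤_; z≤n; s≤s)
import Data.Nat.Properties as ℕ
open import Data.Vec using (Vec; []; _∷_; replicate)
open import Data.Product using (_×_; _,_; proj₁)
open import Data.Maybe using (nothing)
open import Function using (_∘_; const)
open import Relation.Binary.Definitions using (DecidableEquality)
open import Relation.Binary.PropositionalEquality
  using (_≡_; _≢_; refl; sym; trans; cong; cong₂; module ≡-Reasoning)
open import Relation.Nullary using (¬_; Dec; does; yes; no; ¬?)
open import Relation.Unary using (Pred; Decidable)
open import Tactic.RingSolver.Core.AlmostCommutativeRing using (fromCommutativeRing)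
import Tactic.RingSolver.NonReflective as Solver

count : ∀ {A : Set} {P : Pred A 0ℓ} → Decidable P → List A → ℕ
count P? xs = length (filter P? xs)

module ListSum {M : Set} {_∙_ : M → M → M} {ε : M}
  (isCommutativeMonoid : IsCommutativeMonoid _≡_ _∙_ ε) where

  commutativeMonoid : CommutativeMonoid 0ℓ 0ℓ
  commutativeMonoid = record { isCommutativeMonoid = isCommutativeMonoid }

  open CommutativeMonoid commutativeMonoid using (identityˡ; identityʳ; rawMonoid; commutativeSemigroup)
  open import Algebra.Properties.CommutativeSemigroup commutativeSemigroup using (interchange)
  open import Algebra.Definitions.RawMonoid rawMonoid public using () renaming (_×_ to _·_)
  open ≡-Reasoning

  private variable A B : Set

  sum : (A → M) → List A → M
  sum f []       = ε
  sum f (x ∷ xs) = f x ∙ sum f xs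

  infix 5 _when_
  _when_ : ∀ {P : Set} → M → Dec P → M
  c when P? = if does P? then c else ε

  sum-cong-∈ : ∀ {f g : A → M} xs → (∀ x → x ∈ xs → f x ≡ g x) → sum f xs ≡ sum g xs
  sum-cong-∈ []       e = refl
  sum-cong-∈ (x ∷ xs) e = cong₂ _∙_ (e x (here refl)) (sum-cong-∈ xs (λ y y∈ → e y (there y∈)))

  sum-cong : ∀ {f g : A → M} xs → (∀ x → f x ≡ g x) → sum f xs ≡ sum g xs
  sum-cong xs e = sum-cong-∈ xs (λ x _ → e x)

  sum-ε : (xs : List A) → sum (const ε) xs ≡ ε
  sum-ε []       = refl
  sum-ε (x ∷ xs) = trans (cong (ε ∙_) (sum-ε xs)) (identityˡ ε)

  sum-distrib-∙ : (f g : A → M) (xs : List A) → sum (λ x → f x ∙ g x) xs ≡ sum f xs ∙ sum g xs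
  sum-distrib-∙ f g []       = sym (identityˡ ε)
  sum-distrib-∙ f g (x ∷ xs) =
    trans (cong (_ ∙_) (sum-distrib-∙ f g xs)) (interchange (f x) (g x) (sum f xs) (sum g xs))

  sum-swap : (h : A → B → M) (xs : List A) (ys : List B) →
             sum (λ x → sum (h x) ys) xs ≡ sum (λ y → sum (λ x → h x y) xs) ys
  sum-swap h []       ys = sym (sum-ε ys)
  sum-swap h (x ∷ xs) ys =
    trans (cong (_ ∙_) (sum-swap h xs ys)) (sym (sum-distrib-∙ (h x) _ ys))

  sum-when-none : ∀ {D : Pred A 0ℓ} (D? : Decidable D) (g : A → M) (xs : List A) →
                  All (¬_ ∘ D) xs → sum (λ u → g u when D? u) xs ≡ ε
  sum-when-none D? g []       _            = refl
  sum-when-none D? g (x ∷ xs) (¬Dx All.∷ ¬D) with D? x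
  ... | yes Dx = ⊥-elim (¬Dx Dx)
  ... | no  _  = trans (identityˡ _) (sum-when-none D? g xs ¬D)

  sum-when-unique : ∀ {D : Pred A 0ℓ} (D? : Decidable D) (g : A → M) {v} →
                    (∀ u → D u → u ≡ v) → D v → ∀ {xs} → Unique xs → v ∈ xs →
                    sum (λ u → g u when D? u) xs ≡ g v
  sum-when-unique D? g only-v Dv {x ∷ xs} (x∉ ∷ uxs) v∈ with D? x | v∈
  ... | yes Dx | _ with refl ← only-v x Dx =
    trans (cong (g x ∙_) (sum-when-none D? g xs (All.map (λ x≢u Du → x≢u (sym (only-v _ Du))) x∉)))
          (identityʳ (g x))
  ... | no ¬Dx | here refl = ⊥-elim (¬Dx Dv)
  ... | no _   | there v∈xs = trans (identityˡ _) (sum-when-unique D? g only-v Dv uxs v∈xs)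

  sum-const-when : ∀ {P : Pred A 0ℓ} (P? : Decidable P) (c : M) (xs : List A) →
                   sum (λ x → c when P? x) xs ≡ count P? xs · c
  sum-const-when P? c []       = refl
  sum-const-when P? c (x ∷ xs) with P? x
  ... | yes _ = cong (c ∙_) (sum-const-when P? c xs)
  ... | no  _ = trans (identityˡ _) (sum-const-when P? c xs)

  sum-over-fibres : (_≟_ : DecidableEquality B) (φ : A → B) {S : List B} → Unique S → (∀ x → φ x ∈ S) →
                    (g : B → M) (xs : List A) → sum (g ∘ φ) xs ≡ sum (λ u → sum (λ x → g u when φ x ≟ u) xs) S
  sum-over-fibres _≟_ φ {S} uniqueS φ∈S g xs = begin
    sum (g ∘ φ) xs
      ≡⟨ sum-cong xs (λ x → sym (sum-when-unique (φ x ≟_) g (λ _ → sym) refl uniqueS (φ∈S x))) ⟩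
    sum (λ x → sum (λ u → g u when φ x ≟ u) S) xs
      ≡⟨ sum-swap (λ x u → g u when φ x ≟ u) xs S ⟩
    sum (λ u → sum (λ x → g u when φ x ≟ u) xs) S ∎

  sum-fibres : (_≟_ : DecidableEquality B) (φ : A → B) {S : List B} → Unique S → (∀ x → φ x ∈ S) →
               (g : B → M) (xs : List A) → sum (g ∘ φ) xs ≡ sum (λ u → count (λ x → φ x ≟ u) xs · g u) S
  sum-fibres _≟_ φ {S} uniqueS φ∈S g xs =
    trans (sum-over-fibres _≟_ φ uniqueS φ∈S g xs)
          (sum-cong S (λ u → sum-const-when (λ x → φ x ≟ u) (g u) xs))

  sum-reindex : (_≟_ : DecidableEquality A) {E : List A} → Unique E → (∀ x → x ∈ E) →
                (φ ψ : A → A) → (∀ x y → φ x ≡ y → x ≡ ψ y) → (∀ y → φ (ψ y) ≡ y) →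
                (g : A → M) → sum (g ∘ φ) E ≡ sum g E
  sum-reindex _≟_ {E} uniqueE complete φ ψ φx≡y⇒x≡ψy φ∘ψ g =
    trans (sum-over-fibres _≟_ φ uniqueE (complete ∘ φ) g E)
          (sum-cong E (λ y → sum-when-unique (λ x → φ x ≟ y) (const (g y)) (λ x → φx≡y⇒x≡ψy x y)
                                             (φ∘ψ y) uniqueE (complete (ψ y))))

module ℕSum = ListSum ℕ.+-0-isCommutativeMonoid
module ℤSum = ListSum ℤ.+-0-isCommutativeMonoid
open ℕSum using (sum)

n·1≡n : ∀ n → n ℕSum.· 1 ≡ n
n·1≡n zero    = refl
n·1≡n (suc n) = cong suc (n·1≡n n)

module _ {A : Set} where

  length≡sum-1 : (xs : List A) → length xs ≡ sum (const 1) xs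
  length≡sum-1 []       = refl
  length≡sum-1 (x ∷ xs) = cong suc (length≡sum-1 xs)

  count-mono : ∀ {P Q : Pred A 0ℓ} (P? : Decidable P) (Q? : Decidable Q) {xs} →
               All (λ x → P x → Q x) xs → count P? xs ≤ count Q? xs
  count-mono P? Q? {[]}     All.[]           = z≤n
  count-mono P? Q? {x ∷ xs} (P⇒Q All.∷ P⇒Qs) with P? x | Q? x
  ... | yes _  | yes _  = s≤s (count-mono P? Q? P⇒Qs)
  ... | yes Px | no ¬Qx = ⊥-elim (¬Qx (P⇒Q Px))
  ... | no _   | yes _  = ℕ.m≤n⇒m≤1+n (count-mono P? Q? P⇒Qs)
  ... | no _   | no _   = count-mono P? Q? P⇒Qs

  count-complement : ∀ {P : Pred A 0ℓ} (P? : Decidable P) xs →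
                     length xs ≡ count P? xs ℕ.+ count (¬? ∘ P?) xs
  count-complement P? []       = refl
  count-complement P? (x ∷ xs) with P? x
  ... | yes _ = cong suc (count-complement P? xs)
  ... | no  _ = trans (cong suc (count-complement P? xs)) (sym (ℕ.+-suc _ _))

  count-unique : ∀ {P : Pred A 0ℓ} (P? : Decidable P) {v} → (∀ u → P u → u ≡ v) → P v →
                 ∀ {xs} → Unique xs → v ∈ xs → count P? xs ≡ 1
  count-unique P? only-v Pv {xs} uniqueXs v∈xs = begin
    count P? xs                    ≡⟨ sym (n·1≡n (count P? xs)) ⟩
    count P? xs ℕSum.· 1           ≡⟨ sym (ℕSum.sum-const-when P? 1 xs) ⟩
    sum (λ x → 1 ℕSum.when P? x) xs ≡⟨ ℕSum.sum-when-unique P? (const 1) only-v Pv uniqueXs v∈xs ⟩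
    1                              ∎
    where open ≡-Reasoning

  sum-bounded : (g : A → ℕ) {q : ℕ} → (∀ x → g x ≤ q) → ∀ xs → sum g xs ≤ length xs ℕ.* q
  sum-bounded g g≤q []       = z≤n
  sum-bounded g g≤q (x ∷ xs) = ℕ.+-mono-≤ (g≤q x) (sum-bounded g g≤q xs)

  sum-bounded-tight : (g : A → ℕ) {q : ℕ} → (∀ x → g x ≤ q) → ∀ xs → length xs ℕ.* q ≤ sum g xs →
                      ∀ {x} → x ∈ xs → g x ≡ q
  sum-bounded-tight g {q} g≤q (y ∷ ys) tight (here refl) =
    ℕ.≤-antisym (g≤q y)
      (ℕ.+-cancelʳ-≤ _ q (g y) (ℕ.≤-trans tight (ℕ.+-monoʳ-≤ (g y) (sum-bounded g g≤q ys))))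
  sum-bounded-tight g {q} g≤q (y ∷ ys) tight (there x∈ys) =
    sum-bounded-tight g g≤q ys
      (ℕ.+-cancelˡ-≤ q _ _ (ℕ.≤-trans tight (ℕ.+-monoˡ-≤ (sum g ys) (g≤q y)))) x∈ys

ℤ-sum-distribˡ : ∀ {A : Set} c (f : A → ℤ) xs → ℤSum.sum (λ x → c ℤ.* f x) xs ≡ c ℤ.* ℤSum.sum f xs
ℤ-sum-distribˡ c f []       = sym (ℤ.*-zeroʳ c)
ℤ-sum-distribˡ c f (x ∷ xs) =
  trans (cong (ℤ._+_ (c ℤ.* f x)) (ℤ-sum-distribˡ c f xs)) (sym (ℤ.*-distribˡ-+ c (f x) _))

n·c≡+n*c : ∀ n c → n ℤSum.· c ≡ ℤ.+ n ℤ.* c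
n·c≡+n*c zero    c = sym (ℤ.*-zeroˡ c)
n·c≡+n*c (suc n) c = trans (cong (ℤ._+_ c) (n·c≡+n*c n c)) (sym (ℤ.suc-* (ℤ.+ n) c))

module FiniteField {n : ℕ} (K : GF2 n) where
  open GF2 K
  open IsCommutativeRing isCommutativeRing
    using (+-assoc; +-identityˡ; +-identityʳ; *-assoc; *-comm; *-identityˡ; *-identityʳ;
           distribʳ; zeroˡ; zeroʳ; *-isCommutativeMonoid)
  open ≡-Reasoning

  commutativeRing : CommutativeRing 0ℓ 0ℓ
  commutativeRing = record { isCommutativeRing = isCommutativeRing }

  open Solver (fromCommutativeRing commutativeRing (λ _ → nothing)) using (solve; _⊜_; _⊕_; _⊗_)

  x+x≡0 : ∀ x → x + x ≡ 0#
  x+x≡0 x = begin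
    x + x             ≡⟨ sym (cong₂ _+_ (*-identityˡ x) (*-identityˡ x)) ⟩
    1# * x + 1# * x   ≡⟨ sym (distribʳ x 1# 1#) ⟩
    (1# + 1#) * x     ≡⟨ cong (_* x) char2 ⟩
    0# * x            ≡⟨ zeroˡ x ⟩
    0#                ∎

  x≡y⇒x+y≡0 : ∀ {x y} → x ≡ y → x + y ≡ 0#
  x≡y⇒x+y≡0 {x} refl = x+x≡0 x

  *-cancelʳ-≢0 : ∀ {x y z} → z ≢ 0# → x * z ≡ y * z → x ≡ y
  *-cancelʳ-≢0 {x} {y} {z} z≢0 xz≡yz with z⁻¹ , zz⁻¹≡1 ← inverse z z≢0 = begin
    x                ≡⟨ sym (*-identityʳ x) ⟩
    x * 1#           ≡⟨ cong (x *_) (sym zz⁻¹≡1) ⟩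
    x * (z * z⁻¹)    ≡⟨ sym (*-assoc x z z⁻¹) ⟩
    (x * z) * z⁻¹    ≡⟨ cong (_* z⁻¹) xz≡yz ⟩
    (y * z) * z⁻¹    ≡⟨ *-assoc y z z⁻¹ ⟩
    y * (z * z⁻¹)    ≡⟨ cong (y *_) zz⁻¹≡1 ⟩
    y * 1#           ≡⟨ *-identityʳ y ⟩
    y                ∎

  *-≢0 : ∀ {x y} → x ≢ 0# → y ≢ 0# → x * y ≢ 0#
  *-≢0 {x} {y} x≢0 y≢0 xy≡0 = x≢0 (*-cancelʳ-≢0 y≢0 (trans xy≡0 (sym (zeroˡ y))))

  commutativeSemiring : CommutativeSemiring 0ℓ 0ℓ
  commutativeSemiring = CommutativeRing.commutativeSemiring commutativeRing

  open import Algebra.Definitions.RawSemiring (CommutativeSemiring.rawSemiring commutativeSemiring)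
    using () renaming (_^_ to _^ʳ_)
  import Algebra.Properties.CommutativeSemiring.Exp commutativeSemiring as Exp

  ^≡^ʳ : ∀ x k → x ^ k ≡ x ^ʳ k
  ^≡^ʳ x zero    = refl
  ^≡^ʳ x (suc k) = cong (x *_) (^≡^ʳ x k)

  ^-homo-* : ∀ x k l → x ^ (k ℕ.+ l) ≡ x ^ k * x ^ l
  ^-homo-* x k l rewrite ^≡^ʳ x (k ℕ.+ l) | ^≡^ʳ x k | ^≡^ʳ x l = Exp.^-homo-* x k l

  ^-assocʳ : ∀ x k l → (x ^ k) ^ l ≡ x ^ (k ℕ.* l)
  ^-assocʳ x k l rewrite ^≡^ʳ (x ^ k) l | ^≡^ʳ x k | ^≡^ʳ x (k ℕ.* l) = Exp.^-assocʳ x k l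

  ^-distrib-* : ∀ x y k → (x * y) ^ k ≡ x ^ k * y ^ k
  ^-distrib-* x y k rewrite ^≡^ʳ (x * y) k | ^≡^ʳ x k | ^≡^ʳ y k = Exp.^-distrib-* x y k

  ^-comm : ∀ x k l → (x ^ k) ^ l ≡ (x ^ l) ^ k
  ^-comm x k l = begin
    (x ^ k) ^ l    ≡⟨ ^-assocʳ x k l ⟩
    x ^ (k ℕ.* l)  ≡⟨ cong (x ^_) (ℕ.*-comm k l) ⟩
    x ^ (l ℕ.* k)  ≡⟨ sym (^-assocʳ x l k) ⟩
    (x ^ l) ^ k    ∎

  x^1≡x : ∀ x → x ^ 1 ≡ x
  x^1≡x = *-identityʳ

  x^2≡x*x : ∀ x → x ^ 2 ≡ x * x
  x^2≡x*x x = cong (x *_) (x^1≡x x)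

  0^2^k≡0 : ∀ k → 0# ^ (2 ℕ.^ k) ≡ 0#
  0^2^k≡0 k with 2 ℕ.^ k | ℕ.m^n≢0 2 k
  ... | suc _ | _ = zeroˡ _

  frobenius : ∀ k x y → (x + y) ^ (2 ℕ.^ k) ≡ x ^ (2 ℕ.^ k) + y ^ (2 ℕ.^ k)
  frobenius zero    x y = trans (x^1≡x (x + y)) (sym (cong₂ _+_ (x^1≡x x) (x^1≡x y)))
  frobenius (suc k) x y = begin
    (x + y) ^ (2 ℕ.* q)         ≡⟨ sym (^-assocʳ (x + y) 2 q) ⟩
    ((x + y) ^ 2) ^ q           ≡⟨ cong (_^ q) square-+ ⟩
    (x ^ 2 + y ^ 2) ^ q         ≡⟨ frobenius k (x ^ 2) (y ^ 2) ⟩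
    (x ^ 2) ^ q + (y ^ 2) ^ q   ≡⟨ cong₂ _+_ (^-assocʳ x 2 q) (^-assocʳ y 2 q) ⟩
    x ^ (2 ℕ.* q) + y ^ (2 ℕ.* q) ∎
    where
    q = 2 ℕ.^ k
    square-+ : (x + y) ^ 2 ≡ x ^ 2 + y ^ 2
    square-+ = begin
      (x + y) ^ 2                       ≡⟨ x^2≡x*x (x + y) ⟩
      (x + y) * (x + y)                 ≡⟨ solve 2 (λ x y → ((x ⊕ y) ⊗ (x ⊕ y)) ⊜ ((x ⊗ x ⊕ y ⊗ y) ⊕ (x ⊗ y ⊕ x ⊗ y))) refl x y ⟩
      (x * x + y * y) + (x * y + x * y) ≡⟨ cong ((x * x + y * y) +_) (x+x≡0 (x * y)) ⟩
      (x * x + y * y) + 0#              ≡⟨ +-identityʳ _ ⟩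
      x * x + y * y                     ≡⟨ sym (cong₂ _+_ (x^2≡x*x x) (x^2≡x*x y)) ⟩
      x ^ 2 + y ^ 2                     ∎

  monic : ∀ {d} → Vec Carrier d → Carrier → Carrier
  monic []       x = 1#
  monic (c ∷ cs) x = c + x * monic cs x

  quotient : ∀ {d} → Carrier → Vec Carrier d → Vec Carrier d
  quotient r []       = []
  quotient r (c ∷ cs) = monic (c ∷ cs) r ∷ quotient r cs

  -- p(y) − p(r) = (y − r) q(y), with both sides moved so that no subtraction occurs.
  monic-division : ∀ {d} r c (cs : Vec Carrier d) y →
                   monic (c ∷ cs) y + r * monic (quotient r cs) y ≡ y * monic (quotient r cs) y + monic (c ∷ cs) r
  monic-division r c [] y =
    solve 4 (λ r c y o → ((c ⊕ y ⊗ o) ⊕ r ⊗ o) ⊜ (y ⊗ o ⊕ (c ⊕ r ⊗ o))) refl r c y 1#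
  monic-division r c (c′ ∷ cs) y = begin
    (c + y * P) + r * (V + y * Q)  ≡⟨ solve 6 (λ r c y p v q → ((c ⊕ y ⊗ p) ⊕ r ⊗ (v ⊕ y ⊗ q)) ⊜ ((c ⊕ y ⊗ (p ⊕ r ⊗ q)) ⊕ r ⊗ v)) refl r c y P V Q ⟩
    (c + y * (P + r * Q)) + r * V  ≡⟨ cong (λ t → (c + y * t) + r * V) (monic-division r c′ cs y) ⟩
    (c + y * (y * Q + V)) + r * V  ≡⟨ solve 6 (λ r c y p v q → ((c ⊕ y ⊗ (y ⊗ q ⊕ v)) ⊕ r ⊗ v) ⊜ (y ⊗ (v ⊕ y ⊗ q) ⊕ (c ⊕ r ⊗ v))) refl r c y P V Q ⟩
    y * (V + y * Q) + (c + r * V)  ∎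
    where
    P = monic (c′ ∷ cs) y
    V = monic (c′ ∷ cs) r
    Q = monic (quotient r cs) y

  root-of-quotient : ∀ {d r y} c (cs : Vec Carrier d) → r ≢ y →
                     monic (c ∷ cs) r ≡ 0# → monic (c ∷ cs) y ≡ 0# → monic (quotient r cs) y ≡ 0#
  root-of-quotient {r = r} {y} c cs r≢y pr≡0 py≡0 with monic (quotient r cs) y ≟ 0#
  ... | yes Q≡0 = Q≡0
  ... | no  Q≢0 = ⊥-elim (r≢y (*-cancelʳ-≢0 Q≢0 (begin
    r * Q                   ≡⟨ sym (+-identityˡ (r * Q)) ⟩
    0# + r * Q              ≡⟨ cong (_+ r * Q) (sym py≡0) ⟩
    monic (c ∷ cs) y + r * Q ≡⟨ monic-division r c cs y ⟩
    y * Q + monic (c ∷ cs) r ≡⟨ cong (y * Q +_) pr≡0 ⟩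
    y * Q + 0#              ≡⟨ +-identityʳ (y * Q) ⟩
    y * Q                   ∎)))
    where Q = monic (quotient r cs) y

  monic-roots : ∀ {d} (cs : Vec Carrier d) {xs} → Unique xs → count (λ x → monic cs x ≟ 0#) xs ≤ d
  monic-roots cs {[]}     []              = z≤n
  monic-roots cs {x ∷ xs} (x∉xs ∷ uniqueXs) with monic cs x ≟ 0#
  ... | no _ = monic-roots cs uniqueXs
  monic-roots []       {x ∷ xs} _ | yes 1≡0 = ⊥-elim (0≢1 (sym 1≡0))
  monic-roots (c ∷ cs) {x ∷ xs} (x∉xs ∷ uniqueXs) | yes px≡0 =
    s≤s (ℕ.≤-trans (count-mono _ _ (All.map (λ x≢y → root-of-quotient c cs x≢y px≡0) x∉xs))
                   (monic-roots (quotient x cs) uniqueXs))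

  module ∏ = ListSum *-isCommutativeMonoid
  open ∏ using () renaming (sum to prod)

  nonzero? : Decidable (_≢ 0#)
  nonzero? y = ¬? (y ≟ 0#)

  -- Multiplication by x ≢ 0 permutes K; comparing the products of all elements, with 0 replaced
  -- by 1, before and after gives x^{|K| − 1} = 1.
  0↦1 : Carrier → Carrier
  0↦1 y = if does (y ≟ 0#) then 1# else y

  0↦1-0 : ∀ {y} → y ≡ 0# → 0↦1 y ≡ 1#
  0↦1-0 {y} y≡0 with y ≟ 0#
  ... | yes _   = refl
  ... | no  y≢0 = ⊥-elim (y≢0 y≡0)

  0↦1-≢0 : ∀ {y} → y ≢ 0# → 0↦1 y ≡ y
  0↦1-≢0 {y} y≢0 with y ≟ 0#
  ... | yes y≡0 = ⊥-elim (y≢0 y≡0)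
  ... | no  _   = refl

  prod-0↦1-≢0 : ∀ ys → prod 0↦1 ys ≢ 0#
  prod-0↦1-≢0 []       = λ 1≡0 → 0≢1 (sym 1≡0)
  prod-0↦1-≢0 (y ∷ ys) = *-≢0 0↦1y≢0 (prod-0↦1-≢0 ys)
    where
    0↦1y≢0 : 0↦1 y ≢ 0#
    0↦1y≢0 with y ≟ 0#
    ... | yes _   = λ 1≡0 → 0≢1 (sym 1≡0)
    ... | no  y≢0 = y≢0

  prod-0↦1-scale : ∀ {x} → x ≢ 0# → ∀ ys →
                   prod (0↦1 ∘ (x *_)) ys ≡ x ^ count nonzero? ys * prod 0↦1 ys
  prod-0↦1-scale x≢0 [] = sym (*-identityˡ 1#)
  prod-0↦1-scale {x} x≢0 (y ∷ ys) with y ≟ 0#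
  ... | yes y≡0 = begin
    0↦1 (x * y) * prod (0↦1 ∘ (x *_)) ys ≡⟨ cong₂ _*_ (0↦1-0 (trans (cong (x *_) y≡0) (zeroʳ x))) (prod-0↦1-scale x≢0 ys) ⟩
    1# * (x ^ k * prod 0↦1 ys)          ≡⟨ solve 3 (λ o a b → (o ⊗ (a ⊗ b)) ⊜ (a ⊗ (o ⊗ b))) refl 1# (x ^ k) _ ⟩
    x ^ k * (1# * prod 0↦1 ys)          ∎
    where k = count nonzero? ys
  ... | no y≢0 = begin
    0↦1 (x * y) * prod (0↦1 ∘ (x *_)) ys ≡⟨ cong₂ _*_ (0↦1-≢0 (*-≢0 x≢0 y≢0)) (prod-0↦1-scale x≢0 ys) ⟩
    (x * y) * (x ^ k * prod 0↦1 ys)      ≡⟨ solve 4 (λ x y a b → ((x ⊗ y) ⊗ (a ⊗ b)) ⊜ ((x ⊗ a) ⊗ (y ⊗ b))) refl x y (x ^ k) _ ⟩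
    (x * x ^ k) * (y * prod 0↦1 ys)      ∎
    where k = count nonzero? ys

  card≡1+nonzero : 2 ℕ.^ n ≡ suc (count nonzero? elems)
  card≡1+nonzero = begin
    2 ℕ.^ n                                              ≡⟨ sym elems-card ⟩
    length elems                                         ≡⟨ count-complement (_≟ 0#) elems ⟩
    count (_≟ 0#) elems ℕ.+ count nonzero? elems         ≡⟨ cong (ℕ._+ count nonzero? elems) one-zero ⟩
    suc (count nonzero? elems)                           ∎
    where
    one-zero : count (_≟ 0#) elems ≡ 1
    one-zero = count-unique (_≟ 0#) (λ _ y≡0 → y≡0) refl elems-unique (elems-complete 0#)

  fermat : ∀ x → x ^ (2 ℕ.^ n) ≡ x
  fermat x with x ≟ 0#
  ... | yes refl = trans (cong (0# ^_) card≡1+nonzero) (zeroˡ _)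
  ... | no x≢0 with x⁻¹ , xx⁻¹≡1 ← inverse x x≢0 = begin
    x ^ (2 ℕ.^ n)              ≡⟨ cong (x ^_) card≡1+nonzero ⟩
    x * x ^ count nonzero? elems ≡⟨ cong (x *_) x^k≡1 ⟩
    x * 1#                     ≡⟨ *-identityʳ x ⟩
    x                          ∎
    where
    x*y≡z⇒y≡x⁻¹*z : ∀ y z → x * y ≡ z → y ≡ x⁻¹ * z
    x*y≡z⇒y≡x⁻¹*z y z xy≡z = begin
      y              ≡⟨ sym (*-identityˡ y) ⟩
      1# * y         ≡⟨ cong (_* y) (trans (sym xx⁻¹≡1) (*-comm x x⁻¹)) ⟩
      (x⁻¹ * x) * y  ≡⟨ *-assoc x⁻¹ x y ⟩
      x⁻¹ * (x * y)  ≡⟨ cong (x⁻¹ *_) xy≡z ⟩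
      x⁻¹ * z        ∎
    x*[x⁻¹*z]≡z : ∀ z → x * (x⁻¹ * z) ≡ z
    x*[x⁻¹*z]≡z z = trans (sym (*-assoc x x⁻¹ z)) (trans (cong (_* z) xx⁻¹≡1) (*-identityˡ z))
    x^k≡1 : x ^ count nonzero? elems ≡ 1#
    x^k≡1 = *-cancelʳ-≢0 (prod-0↦1-≢0 elems) (begin
      x ^ count nonzero? elems * prod 0↦1 elems ≡⟨ sym (prod-0↦1-scale x≢0 elems) ⟩
      prod (0↦1 ∘ (x *_)) elems                 ≡⟨ ∏.sum-reindex _≟_ elems-unique elems-complete (x *_) (x⁻¹ *_) x*y≡z⇒y≡x⁻¹*z x*[x⁻¹*z]≡z 0↦1 ⟩
      prod 0↦1 elems                            ≡⟨ sym (*-identityˡ _) ⟩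
      1# * prod 0↦1 elems                       ∎)

  monic-xᵏ : ∀ k x → monic (replicate k 0#) x ≡ x ^ k
  monic-xᵏ zero    x = refl
  monic-xᵏ (suc k) x = trans (+-identityˡ _) (cong (x *_) (monic-xᵏ k x))

  monic-x²⁺ᵏ+x+c : ∀ k c x → monic (c ∷ 1# ∷ replicate k 0#) x ≡ (x ^ (2 ℕ.+ k) + x) + c
  monic-x²⁺ᵏ+x+c k c x = begin
    c + x * (1# + x * monic (replicate k 0#) x) ≡⟨ cong (λ t → c + x * (1# + x * t)) (monic-xᵏ k x) ⟩
    c + x * (1# + x * x ^ k)                    ≡⟨ solve 4 (λ c x z o → (c ⊕ x ⊗ (o ⊕ x ⊗ z)) ⊜ ((x ⊗ (x ⊗ z) ⊕ x ⊗ o) ⊕ c)) refl c x (x ^ k) 1# ⟩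
    (x * (x * x ^ k) + x * 1#) + c              ≡⟨ cong (λ t → (x ^ (2 ℕ.+ k) + t) + c) (*-identityʳ x) ⟩
    (x ^ (2 ℕ.+ k) + x) + c                     ∎

  Tr-+ : ∀ t x y → Tr t (x + y) ≡ Tr t x + Tr t y
  Tr-+ zero    x y = sym (+-identityˡ 0#)
  Tr-+ (suc t) x y = begin
    (x + y) ^ (2 ℕ.^ t) + Tr t (x + y)                 ≡⟨ cong₂ _+_ (frobenius t x y) (Tr-+ t x y) ⟩
    (x ^ (2 ℕ.^ t) + y ^ (2 ℕ.^ t)) + (Tr t x + Tr t y) ≡⟨ solve 4 (λ a b c d → ((a ⊕ b) ⊕ (c ⊕ d)) ⊜ ((a ⊕ c) ⊕ (b ⊕ d))) refl _ _ _ _ ⟩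
    (x ^ (2 ℕ.^ t) + Tr t x) + (y ^ (2 ℕ.^ t) + Tr t y) ∎

  Tr-split : ∀ k l x → Tr (k ℕ.+ l) x ≡ Tr k (x ^ (2 ℕ.^ l)) + Tr l x
  Tr-split zero    l x = sym (+-identityˡ _)
  Tr-split (suc k) l x = begin
    x ^ (2 ℕ.^ (k ℕ.+ l)) + Tr (k ℕ.+ l) x                   ≡⟨ cong₂ _+_ power (Tr-split k l x) ⟩
    (x ^ (2 ℕ.^ l)) ^ (2 ℕ.^ k) + (Tr k (x ^ (2 ℕ.^ l)) + Tr l x) ≡⟨ sym (+-assoc _ _ _) ⟩
    ((x ^ (2 ℕ.^ l)) ^ (2 ℕ.^ k) + Tr k (x ^ (2 ℕ.^ l))) + Tr l x ∎
    where
    power : x ^ (2 ℕ.^ (k ℕ.+ l)) ≡ (x ^ (2 ℕ.^ l)) ^ (2 ℕ.^ k)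
    power = begin
      x ^ (2 ℕ.^ (k ℕ.+ l))            ≡⟨ cong (x ^_) (ℕ.^-distribˡ-+-* 2 k l) ⟩
      x ^ (2 ℕ.^ k ℕ.* 2 ℕ.^ l)        ≡⟨ cong (x ^_) (ℕ.*-comm (2 ℕ.^ k) (2 ℕ.^ l)) ⟩
      x ^ (2 ℕ.^ l ℕ.* 2 ℕ.^ k)        ≡⟨ sym (^-assocʳ x (2 ℕ.^ l) (2 ℕ.^ k)) ⟩
      (x ^ (2 ℕ.^ l)) ^ (2 ℕ.^ k)      ∎

  Tr≡⇒χ≡ : ∀ {t t′ x y} → Tr t x ≡ Tr t′ y → χ t x ≡ χ t′ y
  Tr≡⇒χ≡ {t} {t′} {x} {y} Trx≡Try with Tr t x ≟ 0# | Tr t′ y ≟ 0#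
  ... | yes _     | yes _     = refl
  ... | yes Trx≡0 | no  Try≢0 = ⊥-elim (Try≢0 (trans (sym Trx≡Try) Trx≡0))
  ... | no  Trx≢0 | yes Try≡0 = ⊥-elim (Trx≢0 (trans Trx≡Try Try≡0))
  ... | no  _     | no  _     = refl

  evalL-+ : ∀ L x y → evalL L (x + y) ≡ evalL L x + evalL L y
  evalL-+ []             x y = sym (+-identityˡ 0#)
  evalL-+ ((α , a) ∷ ps) x y = begin
    α * (x + y) ^ (2 ℕ.^ a) + evalL ps (x + y)
      ≡⟨ cong₂ (λ u v → α * u + v) (frobenius a x y) (evalL-+ ps x y) ⟩
    α * (x ^ (2 ℕ.^ a) + y ^ (2 ℕ.^ a)) + (evalL ps x + evalL ps y)
      ≡⟨ solve 5 (λ α p q r s → (α ⊗ (p ⊕ q) ⊕ (r ⊕ s)) ⊜ ((α ⊗ p ⊕ r) ⊕ (α ⊗ q ⊕ s))) refl α _ _ _ _ ⟩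
    (α * x ^ (2 ℕ.^ a) + evalL ps x) + (α * y ^ (2 ℕ.^ a) + evalL ps y) ∎

  evalL-frobenius : ∀ m L → All (InSub m ∘ proj₁) L → ∀ x → evalL L x ^ (2 ℕ.^ m) ≡ evalL L (x ^ (2 ℕ.^ m))
  evalL-frobenius m []             _                x = 0^2^k≡0 m
  evalL-frobenius m ((α , a) ∷ ps) (α∈Fq All.∷ ps∈Fq) x = begin
    (α * x ^ (2 ℕ.^ a) + evalL ps x) ^ q           ≡⟨ frobenius m _ _ ⟩
    (α * x ^ (2 ℕ.^ a)) ^ q + evalL ps x ^ q       ≡⟨ cong₂ _+_ (^-distrib-* α _ q) (evalL-frobenius m ps ps∈Fq x) ⟩
    α ^ q * (x ^ (2 ℕ.^ a)) ^ q + evalL ps (x ^ q) ≡⟨ cong₂ (λ u v → u * v + evalL ps (x ^ q)) α∈Fq (^-comm x (2 ℕ.^ a) q) ⟩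
    α * (x ^ q) ^ (2 ℕ.^ a) + evalL ps (x ^ q)     ∎
    where q = 2 ℕ.^ m

  x*evalL≡evalQ : ∀ L x → x * evalL L x ≡ evalQ L x
  x*evalL≡evalQ []             x = zeroʳ x
  x*evalL≡evalQ ((α , a) ∷ ps) x = begin
    x * (α * x ^ (2 ℕ.^ a) + evalL ps x)      ≡⟨ solve 4 (λ x α w r → (x ⊗ (α ⊗ w ⊕ r)) ⊜ (α ⊗ (w ⊗ x) ⊕ x ⊗ r)) refl x α _ _ ⟩
    α * (x ^ (2 ℕ.^ a) * x) + x * evalL ps x  ≡⟨ cong₂ (λ s t → α * s + t) (sym x^[2^a+1]) (x*evalL≡evalQ ps x) ⟩
    α * x ^ ((2 ℕ.^ a) ℕ.+ 1) + evalQ ps x    ∎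
    where
    x^[2^a+1] : x ^ ((2 ℕ.^ a) ℕ.+ 1) ≡ x ^ (2 ℕ.^ a) * x
    x^[2^a+1] = trans (^-homo-* x (2 ℕ.^ a) 1) (cong (x ^ (2 ℕ.^ a) *_) (x^1≡x x))

Σℤ-map : ∀ {A : Set} (f : A → ℤ) xs → Σℤ (map f xs) ≡ ℤSum.sum f xs
Σℤ-map f []       = refl
Σℤ-map f (x ∷ xs) = cong (ℤ._+_ (f x)) (Σℤ-map f xs)

module RelativeTrace (m : ℕ) (m≥1 : 1 ≤ m) (K : GF2 (2 ℕ.* m)) where
  open GF2 K
  open FiniteField K
  open IsCommutativeRing isCommutativeRing using (+-comm; distribˡ)
  open ≡-Reasoning

  q : ℕ
  q = 2 ℕ.^ m

  2m≡m+m : 2 ℕ.* m ≡ m ℕ.+ m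
  2m≡m+m = cong (m ℕ.+_) (ℕ.+-identityʳ m)

  |K|≡q*q : 2 ℕ.^ (2 ℕ.* m) ≡ q ℕ.* q
  |K|≡q*q = trans (cong (2 ℕ.^_) 2m≡m+m) (ℕ.^-distribˡ-+-* 2 m m)

  x^q^q≡x : ∀ x → (x ^ q) ^ q ≡ x
  x^q^q≡x x = trans (^-assocʳ x q q) (trans (cong (x ^_) (sym |K|≡q*q)) (fermat x))

  T : Carrier → Carrier
  T a = a ^ q + a

  T-fixed : ∀ a → T a ^ q ≡ T a
  T-fixed a = begin
    (a ^ q + a) ^ q       ≡⟨ frobenius m (a ^ q) a ⟩
    (a ^ q) ^ q + a ^ q   ≡⟨ cong (_+ a ^ q) (x^q^q≡x a) ⟩
    a + a ^ q             ≡⟨ +-comm a (a ^ q) ⟩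
    a ^ q + a             ∎

  Fq : List Carrier
  Fq = subElems m

  Fq-unique : Unique Fq
  Fq-unique = Unique.filter⁺ (λ u → (u ^ q) ≟ u) elems-unique

  T∈Fq : ∀ a → T a ∈ Fq
  T∈Fq a = ∈-filter⁺ (λ u → (u ^ q) ≟ u) (elems-complete (T a)) (T-fixed a)

  fibre : Carrier → ℕ
  fibre u = count (λ a → T a ≟ u) elems

  fibre≤q : ∀ u → fibre u ≤ q
  fibre≤q u with k , 2+k≡q ← ℕ.m≤n⇒∃[o]m+o≡n (ℕ.^-monoʳ-≤ 2 m≥1) =
    ℕ.≤-trans (count-mono (λ a → T a ≟ u) (λ a → monic x²⁺ᵏ+x+u a ≟ 0#) {elems} (All.tabulate (λ {a} _ → root a)))
    (ℕ.≤-trans (monic-roots x²⁺ᵏ+x+u elems-unique) (ℕ.≤-reflexive 2+k≡q))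
    where
    x²⁺ᵏ+x+u : Vec Carrier (2 ℕ.+ k)
    x²⁺ᵏ+x+u = u ∷ 1# ∷ replicate k 0#
    root : ∀ a → T a ≡ u → monic x²⁺ᵏ+x+u a ≡ 0#
    root a Ta≡u = trans (monic-x²⁺ᵏ+x+c k u a) (x≡y⇒x+y≡0 (trans (cong (λ e → a ^ e + a) 2+k≡q) Ta≡u))

  |Fq|≤q : length Fq ≤ q
  |Fq|≤q = ℕ.≤-trans (count-mono (λ u → (u ^ q) ≟ u) (λ u → T u ≟ 0#) {elems}
                       (All.tabulate (λ {u} _ u^q≡u → x≡y⇒x+y≡0 u^q≡u)))
                     (fibre≤q 0#)

  sum-fibre≡|K| : sum fibre Fq ≡ q ℕ.* q
  sum-fibre≡|K| = begin
    sum fibre Fq                        ≡⟨ ℕSum.sum-cong Fq (λ u → sym (n·1≡n (fibre u))) ⟩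
    sum (λ u → fibre u ℕSum.· 1) Fq      ≡⟨ sym (ℕSum.sum-fibres _≟_ T Fq-unique T∈Fq (const 1) elems) ⟩
    sum (const 1) elems                 ≡⟨ sym (length≡sum-1 elems) ⟩
    length elems                        ≡⟨ elems-card ⟩
    2 ℕ.^ (2 ℕ.* m)                     ≡⟨ |K|≡q*q ⟩
    q ℕ.* q                             ∎

  fibre≡q : ∀ {u} → u ∈ Fq → fibre u ≡ q
  fibre≡q = sum-bounded-tight fibre fibre≤q Fq
    (ℕ.≤-trans (ℕ.*-monoˡ-≤ q |Fq|≤q) (ℕ.≤-reflexive (sym sum-fibre≡|K|)))

  module _ (L : List (Carrier × ℕ)) (L∈Fq : All (InSub m ∘ proj₁) L) where

    χ-descends : ∀ a → χ (2 ℕ.* m) (T a * evalL L a) ≡ χ m (T a * evalL L (T a))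
    χ-descends a = Tr≡⇒χ≡ (begin
      Tr (2 ℕ.* m) z           ≡⟨ cong (λ t → Tr t z) 2m≡m+m ⟩
      Tr (m ℕ.+ m) z           ≡⟨ Tr-split m m z ⟩
      Tr m (z ^ q) + Tr m z    ≡⟨ sym (Tr-+ m (z ^ q) z) ⟩
      Tr m (z ^ q + z)         ≡⟨ cong (Tr m) z^q+z≡TL[T] ⟩
      Tr m (T a * evalL L (T a)) ∎)
      where
      z : Carrier
      z = T a * evalL L a
      z^q+z≡TL[T] : z ^ q + z ≡ T a * evalL L (T a)
      z^q+z≡TL[T] = begin
        (T a * evalL L a) ^ q + z                   ≡⟨ cong (_+ z) (^-distrib-* (T a) _ q) ⟩
        T a ^ q * evalL L a ^ q + z                 ≡⟨ cong₂ (λ s t → s * t + z) (T-fixed a) (evalL-frobenius m L L∈Fq a) ⟩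
        T a * evalL L (a ^ q) + T a * evalL L a     ≡⟨ sym (distribˡ (T a) _ _) ⟩
        T a * (evalL L (a ^ q) + evalL L a)         ≡⟨ cong (T a *_) (sym (evalL-+ L (a ^ q) a)) ⟩
        T a * evalL L (T a)                         ∎

    r≡q*Σχ[uL[u]] : r m K L ≡ ℤ.+ q ℤ.* Σℤ (map (λ u → χ m (u * evalL L u)) Fq)
    r≡q*Σχ[uL[u]] = begin
      r m K L
        ≡⟨ Σℤ-map _ elems ⟩
      ℤSum.sum (λ a → χ (2 ℕ.* m) (T a * evalL L a)) elems
        ≡⟨ ℤSum.sum-cong elems χ-descends ⟩
      ℤSum.sum (f ∘ T) elems
        ≡⟨ ℤSum.sum-fibres _≟_ T Fq-unique T∈Fq f elems ⟩
      ℤSum.sum (λ u → fibre u ℤSum.· f u) Fq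
        ≡⟨ ℤSum.sum-cong-∈ Fq (λ u u∈Fq → trans (cong (ℤSum._· f u) (fibre≡q u∈Fq)) (n·c≡+n*c q (f u))) ⟩
      ℤSum.sum (λ u → ℤ.+ q ℤ.* f u) Fq
        ≡⟨ ℤ-sum-distribˡ (ℤ.+ q) f Fq ⟩
      ℤ.+ q ℤ.* ℤSum.sum f Fq
        ≡⟨ cong (ℤ.+ q ℤ.*_) (sym (Σℤ-map f Fq)) ⟩
      ℤ.+ q ℤ.* Σℤ (map f Fq)                  ∎
      where
      f : Carrier → ℤ
      f u = χ m (u * evalL L u)

open import Data.Nat using (_^_; _*_)
open import Data.Integer using (+_) renaming (_*_ to _*ℤ_)

theorem3 : (m : ℕ) → 1 ≤ m → (K : GF2 (2 * m)) → (L : List (GF2.Carrier K × ℕ))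
    → All (λ p → GF2.InSub K m (proj₁ p)) L
    → (r m K L ≡ (+ (2 ^ m)) *ℤ Σℤ (map (λ u → GF2.χ K m (GF2._*_ K u (GF2.evalL K L u))) (GF2.subElems K m)))
      × (r m K L ≡ (+ (2 ^ m)) *ℤ Σℤ (map (λ u → GF2.χ K m (GF2.evalQ K L u)) (GF2.subElems K m)))
theorem3 m m≥1 K L L∈Fq =
  r≡q*Σχ[uL[u]] L L∈Fq ,
  trans (r≡q*Σχ[uL[u]] L L∈Fq)
        (cong (λ s → + (2 ^ m) *ℤ Σℤ s) (map-cong (λ u → cong (GF2.χ K m) (x*evalL≡evalQ L u)) Fq))
  where
  open RelativeTrace m m≥1 K
  open FiniteField K using (x*evalL≡evalQ)
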